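{- Let $p$ be a prime, $n\ge2$, $F=\mathbb{F}_{p^n}$. Let $f\colon F\to F$ be a GAPN function with $d^\circ(f)=p$. Let $\mu$ assign to each $a\in F^\times$ an $\mathbb{F}_p$-linear automorphism $\mu_a$ of $F$, and let $\nu$ be a permutation of $F$ with $\nu(0)=0$. Suppose that $\tilde B_{f,\mu,\nu}$ is $\mathbb{F}_p$-bilinear. For $a\in F$ put $X(a)=\{(x,\tilde B_{f,\mu,\nu}(x,a)) : x\in F\}\subseteq F\oplus F$. Let $M\subseteq F$ be a set such that no three mutually different elements of $M$ lie on the same line. Then the collection $\{X(a): a\in M\}$ is an $(n-1)$-dimensional dual arc over $\mathbb{F}_p$ in $F\oplus F$ (regarded as an $\mathbb{F}_p$-vector space).
   Context: For $a,x\in F$ put $\tilde{D}_a f(x)=\sum_{j\in\mathbb{F}_p} f(x+ja)$, $\tilde N_f(a,b)=\#\{x\in F:\tilde D_af(x)=b\}$; $f$ is GAPN if $\tilde N_f(a,b)\le p$ for all $a\in F^\times$, $b\in F$. For $m\ge1$, $[f]^m(x_1,\dots,x_m)=\sum_{I\subseteq\{1,\dots,m\}}(-1)^{m-|I|}f\big(\sum_{k\in I}x_k\big)$, $[f]^0=f(0)$; for nonzero $f$, $d^\circ(f)$ is the largest $m\ge0$ with $[f]^m\not\equiv0$. Set $\tilde B_f(x,y)=[f]^p(x,y,\dots,y)$ ($y$ repeated $p-1$ times), and $\tilde B_{f,\mu,\nu}(x,a)=\mu_a(\tilde B_f(x,\nu(a)))$ for $a\ne0$, $\tilde B_{f,\mu,\nu}(x,0)=0$.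 Elements of $F$ lie on the same line if they belong to a set $\{u+tv:t\in\mathbb{F}_p\}$ with $u,v\in F$, $v\neq0$. A collection $\mathcal S$ of $m$-dimensional subspaces of an $\mathbb{F}_q$-vector space is an $(m-1)$-dimensional dual arc over $\mathbb{F}_q$ if $\dim(X\cap Y)=1$ for any different $X,Y\in\mathcal S$ and $X\cap Y\cap Z=0$ for any three mutually different $X,Y,Z\in\mathcal S$. -}

module Defs where

open import Data.Nat using (ℕ; zero; suc; _<_; _≤_)
open import Data.List using (List; []; _∷_; [_]; map; _++_; length; foldr; filter; upTo)
open import Data.List.Membership.Propositional using (_∈_)
open import Data.List.Relation.Unary.Unique.Propositional using (Unique)
open import Data.Vec using (Vec; lookup)
open import Data.Fin using (Fin)
open import Data.Product using (Σ; _×_; _,_; ∃)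
open import Relation.Nullary using (¬_; yes; no)
open import Relation.Binary.PropositionalEquality using (_≡_; _≢_)
open import Relation.Binary.Definitions using (DecidableEquality)
open import Algebra.Structures using (IsCommutativeRing)
open import Function.Definitions using (Bijective)

record FiniteField : Set₁ where
  infixl 6 _+_
  infixl 7 _*_
  field
    Carrier : Set
    _+_ _*_ : Carrier → Carrier → Carrier
    -_ : Carrier → Carrier
    0# 1# : Carrier
    isCommutativeRing : IsCommutativeRing _≡_ _+_ _*_ -_ 0# 1#
    0≢1 : 0# ≢ 1#
    inverse : ∀ a → a ≢ 0# → Σ Carrier (λ b → a * b ≡ 1#)
    _≟_ : DecidableEquality Carrier
    elems : List Carrier
    elems-unique : Unique elems
    elems-complete : ∀ x → x ∈ elems

module FieldDefs (K : FiniteField) where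
  open FiniteField K

  Σl : List Carrier → Carrier
  Σl = foldr _+_ 0#

  -- F_p-scalar action of j ∈ ℕ (j · a = a + ... + a, j times)
  smul : ℕ → Carrier → Carrier
  smul zero a = 0#
  smul (suc j) a = a + smul j a

  sign : ℕ → Carrier
  sign zero = 1#
  sign (suc k) = - sign k

  Dt : ℕ → (Carrier → Carrier) → Carrier → Carrier → Carrier
  Dt p f a x = Σl (map (λ j → f (x + smul j a)) (upTo p))

  Nt : ℕ → (Carrier → Carrier) → Carrier → Carrier → ℕ
  Nt p f a b = length (filter (λ x → Dt p f a x ≟ b) elems)

  GAPN : ℕ → (Carrier → Carrier) → Set
  GAPN p f = ∀ a b → a ≢ 0# → Nt p f a b ≤ p

  -- all sub-lists (= subsets of the index set {1..m})
  subsets : {A : Set} → List A → List (List A)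
  subsets [] = [ [] ]
  subsets (x ∷ xs) = map (x ∷_) (subsets xs) ++ subsets xs

  bracket : (Carrier → Carrier) → List Carrier → Carrier
  bracket f xs = Σl (map (λ I → sign (length xs Data.Nat.∸ length I) * f (Σl I)) (subsets xs))

  AlgDegree : (Carrier → Carrier) → ℕ → Set
  AlgDegree f d =
    (Σ (List Carrier) λ xs → (length xs ≡ d) × (bracket f xs ≢ 0#)) ×
    (∀ xs → d < length xs → bracket f xs ≡ 0#)

  replicate : ℕ → Carrier → List Carrier
  replicate zero y = []
  replicate (suc k) y = y ∷ replicate k y

  Bt : ℕ → (Carrier → Carrier) → Carrier → Carrier → Carrier
  Bt p f x y = bracket f (x ∷ replicate (p Data.Nat.∸ 1) y)

  Btμν : ℕ → (Carrier → Carrier) → ((a : Carrier) → a ≢ 0# → Carrier → Carrier) →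
         (Carrier → Carrier) → Carrier → Carrier → Carrier
  Btμν p f μ ν x a with a ≟ 0#
  ... | yes _ = 0#
  ... | no a≢0 = μ a a≢0 (Bt p f x (ν a))

  IsLinear : (Carrier → Carrier) → Set
  IsLinear g = (∀ x y → g (x + y) ≡ g x + g y) × (∀ j x → g (smul j x) ≡ smul j (g x))

  IsLinearAut : (Carrier → Carrier) → Set
  IsLinearAut g = IsLinear g × Bijective _≡_ _≡_ g

  IsBilinear : (Carrier → Carrier → Carrier) → Set
  IsBilinear B = (∀ a → IsLinear (λ x → B x a)) × (∀ x → IsLinear (λ a → B x a))

  OnLine : ℕ → Carrier → Carrier → Carrier → Set
  OnLine p u v x = Σ ℕ λ t → (t < p) × (x ≡ u + smul t v)

  SameLine : ℕ → Carrier → Carrier → Carrier → Set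
  SameLine p x y z = Σ Carrier λ u → Σ Carrier λ v →
    (v ≢ 0#) × OnLine p u v x × OnLine p u v y × OnLine p u v z

  NoThreeOnLine : ℕ → (Carrier → Set) → Set
  NoThreeOnLine p M = ∀ x y z → M x → M y → M z →
    x ≢ y → y ≢ z → x ≢ z → ¬ SameLine p x y z

  V : Set
  V = Carrier × Carrier

  _+V_ : V → V → V
  (a , b) +V (c , d) = (a + c , b + d)

  smulV : ℕ → V → V
  smulV j (a , b) = (smul j a , smul j b)

  0V : V
  0V = (0# , 0#)

  SubsetV : Set₁
  SubsetV = V → Set

  _∩_ : SubsetV → SubsetV → SubsetV
  (S ∩ T) v = S v × T v

  SameSet : SubsetV → SubsetV → Set
  SameSet S T = ∀ v → (S v → T v) × (T v → S v)

  IsSubspace : SubsetV → Set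
  IsSubspace S = S 0V × (∀ v w → S v → S w → S (v +V w)) × (∀ j v → S v → S (smulV j v))

  lincomb : {k : ℕ} → Vec ℕ k → Vec V k → V
  lincomb Data.Vec.[] Data.Vec.[] = 0V
  lincomb (c Data.Vec.∷ cs) (b Data.Vec.∷ bs) = smulV c b +V lincomb cs bs

  HasDim : ℕ → SubsetV → ℕ → Set
  HasDim p S k = Σ (Vec V k) λ b →
    (∀ i → S (lookup b i)) ×
    (∀ v → S v → Σ (Vec ℕ k) λ c → v ≡ lincomb c b) ×
    (∀ c → (∀ i → lookup c i < p) → lincomb c b ≡ 0V → ∀ i → lookup c i ≡ 0)

  -- {X(a) : a ∈ M} is an (m-1)-dimensional dual arc over F_p
  -- (members are the m-dimensional subspaces X(a); "different" means different as sets)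
  DualArc : ℕ → ℕ → (Carrier → Set) → (Carrier → SubsetV) → Set
  DualArc p m M X =
    (∀ a → M a → IsSubspace (X a) × HasDim p (X a) m) ×
    (∀ a b → M a → M b → ¬ SameSet (X a) (X b) → HasDim p (X a ∩ X b) 1) ×
    (∀ a b c → M a → M b → M c →
       ¬ SameSet (X a) (X b) → ¬ SameSet (X b) (X c) → ¬ SameSet (X a) (X c) →
       ∀ v → ((X a ∩ X b) ∩ X c) v → v ≡ 0V)

  graphX : (Carrier → Carrier → Carrier) → Carrier → SubsetV
  graphX B a (x , y) = y ≡ B x a

-- In characteristic p, expanding [f]^p(x, y, …, y) over the subsets shows it is the (p−1)-th
-- finite difference along y of z ↦ f(x + z) − f(z), whose binomial weights are all ≡ 1; hence
-- B~_f(x, y) = D~_y f(x) − D~_y f(0). Since D~_y f is constant on cosets of F_p·y, the GAPN bound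
-- (at most p solutions of D~_y f = D~_y f(0)) leaves only the coset F_p·y itself, so for a ≠ 0 the
-- kernel of x ↦ B~_{f,μ,ν}(x, a) is the line F_p·ν(a). Since |F| = p^n forces characteristic p
-- and an F_p-basis of n elements, each X(a), the graph of an F_p-linear map, has dimension n.
-- X(a) ∩ X(b) is the graph over the kernel of B(·, a − b), a line. A nonzero point (x, y) of
-- X(a) ∩ X(b) ∩ X(c) would make B(x, ·) vanish on the plane spanned by a − c and b − c
-- (independent as a, b, c are not collinear), so the injective ν would map p² points into the
-- line F_p·x.
module Submission where

open import Defs
open import Data.Nat using (ℕ; _≤_; _^_)
open import Data.Nat.Primality using (Prime)
open import Data.List using (length)
open import Relation.Binary.PropositionalEquality using (_≡_; _≢_)
open import Function.Definitions using (Bijective)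

open import Algebra.Bundles using (CommutativeRing)
import Algebra.Properties.AbelianGroup as AbelianGroupProperties
import Algebra.Properties.CommutativeSemigroup as CommutativeSemigroupProperties
import Algebra.Properties.Ring as RingProperties
open import Data.Empty using (⊥-elim)
open import Data.Fin using (Fin; toℕ; zero; suc; splitAt; join; fromℕ<; combine; finToFun; funToFin)
open import Data.Fin.Properties
  using (pigeonhole; injective⇒≤; any?; join-splitAt; toℕ<n; toℕ-fromℕ<; toℕ-injective;
         finToFun-funToFin; funToFin-finToFin)
open import Data.List using (List; []; _∷_)
import Data.List as List
import Data.List.Properties as List
open import Data.List.Membership.Propositional using (_∈_)
open import Data.List.Membership.Propositional.Properties using (∈-lookup; ∈-filter⁺; ∈-applyUpTo⁺)
open import Data.List.Membership.Setoid.Properties using (index-injective)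
import Data.List.Relation.Unary.All as All
open import Data.List.Relation.Unary.All.Properties using (¬All⇒Any¬; ++⁺; map⁺)
open import Data.List.Relation.Unary.AllPairs using (_∷_)
import Data.List.Relation.Unary.Any as Any
open import Data.List.Relation.Unary.Unique.Propositional using (Unique)
open import Data.Nat as ℕ using (zero; suc; _<_; _∸_; _!; z≤n; s≤s)
open import Data.Nat.Combinatorics
  using (_C_; nCk≡n!/k![n-k]!; k![n∸k]!∣n!; k>n⇒nCk≡0; nCk+nC[k+1]≡[n+1]C[k+1]; nCn≡1)
open import Data.Nat.Coprimality as Coprime using (coprime-Bézout; prime⇒coprime)
open import Data.Nat.Divisibility using (_∣_; divides; ∣⇒≤; ∣1⇒≡1; m∣m*n)
open import Data.Nat.DivMod using (_%_; _/_; m%n<n; m/n*n≡m; m≡m%n+[m/n]*n)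
open import Data.Nat.GCD using (module Bézout)
open import Data.Nat.Induction using (<-rec)
open import Data.Nat.Primality
  using (euclidsLemma; prime⇒irreducible; prime⇒nonTrivial; prime⇒nonZero; prime?;
         ¬prime⇒composite; composite)
open import Data.Nat.Properties as ℕ
  using (<⇒≢; <⇒≱; <⇒≤; n<1+n; <-trans; <-cmp; ≤-<-trans; <-≤-trans; ≤-antisym; ∸-monoʳ-<;
         m∸n+n≡m; m+[n∸m]≡n; m∸n≤m; m<n⇒0<n∸m; +-suc; +-∸-assoc; m<m+n; m<m*n; m^n≢0;
         m^n≡1⇒n≡0∨m≡1; ^-monoʳ-<)
open import Data.Product using (Σ; _×_; _,_; proj₁; proj₂)
open import Data.Sum using (_⊎_; inj₁; inj₂)
open import Data.Vec as Vec using (Vec; []; _∷_; lookup; tabulate; zipWith)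
open import Data.Vec.Properties
  using (lookup-map; lookup-zipWith; tabulate∘lookup; tabulate-cong; lookup∘tabulate)
open import Function using (_∘_; case_of_)
open import Relation.Binary using (tri<; tri≈; tri>)
open import Relation.Binary.PropositionalEquality as ≡
  using (refl; sym; trans; cong; cong₂; subst; module ≡-Reasoning)
open import Relation.Nullary using (¬_; Dec; yes; no)

prime>1 : ∀ {p} → Prime p → 1 < p
prime>1 {p} pr = ℕ.nonTrivial⇒n>1 p {{prime⇒nonTrivial pr}}

n<m^n : ∀ {m} → 1 < m → ∀ n → n < m ^ n
n<m^n 1<m zero = s≤s z≤n
n<m^n {m} 1<m (suc n) = <-≤-trans (s≤s (n<m^n 1<m n)) (subst (m ^ n <_) (ℕ.*-comm (m ^ n) m) m^n<m^n*m)
  where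
  instance
    m^n-nonZero : ℕ.NonZero (m ^ n)
    m^n-nonZero = m^n≢0 m n {{ℕ.>-nonZero (<-trans (s≤s z≤n) 1<m)}}
  m^n<m^n*m : m ^ n < m ^ n ℕ.* m
  m^n<m^n*m = m<m*n (m ^ n) m 1<m

prime∤m! : ∀ {p m} → Prime p → m < p → ¬ p ∣ m !
prime∤m! {m = zero} pr _ p∣1 = <⇒≢ (prime>1 pr) (sym (∣1⇒≡1 p∣1))
prime∤m! {m = suc m} pr m<p p∣m! with euclidsLemma (suc m) (m !) pr p∣m!
... | inj₁ p∣1+m = <⇒≱ m<p (∣⇒≤ p∣1+m)
... | inj₂ p∣m! = prime∤m! pr (<-trans (n<1+n m) m<p) p∣m!

prime∣pCk : ∀ {p k} → Prime p → 0 < k → k < p → p ∣ p C k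
prime∣pCk {suc m} {k} pr 0<k k<p
  with euclidsLemma (suc m C k) (k ! ℕ.* (suc m ∸ k) !) pr p∣C*denominator
  where
  instance
    denominator-nonZero : ℕ.NonZero (k ! ℕ.* (suc m ∸ k) !)
    denominator-nonZero = k ℕ.!* (suc m ∸ k) !≢0
  p∣C*denominator : suc m ∣ (suc m C k) ℕ.* (k ! ℕ.* (suc m ∸ k) !)
  p∣C*denominator = subst (suc m ∣_) p!≡C*denominator (m∣m*n (m !))
    where
    p!≡C*denominator : suc m ! ≡ (suc m C k) ℕ.* (k ! ℕ.* (suc m ∸ k) !)
    p!≡C*denominator = sym (trans (cong (ℕ._* (k ! ℕ.* (suc m ∸ k) !)) (nCk≡n!/k![n-k]! (<⇒≤ k<p)))
                                  (m/n*n≡m (k![n∸k]!∣n! (<⇒≤ k<p))))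
... | inj₁ p∣C = p∣C
... | inj₂ p∣k!*[p-k]! with euclidsLemma (k !) ((suc m ∸ k) !) pr p∣k!*[p-k]!
...   | inj₁ p∣k! = ⊥-elim (prime∤m! pr k<p p∣k!)
...   | inj₂ p∣[p-k]! = ⊥-elim (prime∤m! pr (∸-monoʳ-< 0<k (<⇒≤ k<p)) p∣[p-k]!)

prime∣m^n⇒prime∣m : ∀ {q m n} → Prime q → q ∣ m ^ n → q ∣ m
prime∣m^n⇒prime∣m {n = zero}  q-prime q∣1 = ⊥-elim (<⇒≢ (prime>1 q-prime) (sym (∣1⇒≡1 q∣1)))
prime∣m^n⇒prime∣m {m = m} {suc n} q-prime q∣m^1+n with euclidsLemma m (m ^ n) q-prime q∣m^1+n
... | inj₁ q∣m   = q∣m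
... | inj₂ q∣m^n = prime∣m^n⇒prime∣m {n = n} q-prime q∣m^n

prime-power-base-unique : ∀ {q p k n} → Prime q → Prime p → 1 ℕ.≤ n → q ^ k ≡ p ^ n → q ≡ p
prime-power-base-unique {k = zero} {n} _ p-prime 1≤n 1≡p^n with m^n≡1⇒n≡0∨m≡1 _ n (sym 1≡p^n)
... | inj₁ n≡0 = ⊥-elim (<⇒≢ 1≤n (sym n≡0))
... | inj₂ p≡1 = ⊥-elim (<⇒≢ (prime>1 p-prime) (sym p≡1))
prime-power-base-unique {q} {p} {suc k} {n} q-prime p-prime _ q^k≡p^n
  with prime⇒irreducible p-prime
         (prime∣m^n⇒prime∣m {n = n} q-prime (subst (q ∣_) q^k≡p^n (m∣m*n (q ^ k))))
... | inj₁ q≡1 = ⊥-elim (<⇒≢ (prime>1 q-prime) (sym q≡1))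
... | inj₂ q≡p = q≡p

^-injectiveʳ : ∀ {m k n} → 1 < m → m ^ k ≡ m ^ n → k ≡ n
^-injectiveʳ {m} {k} {n} 1<m m^k≡m^n with <-cmp k n
... | tri< k<n _ _ = ⊥-elim (<⇒≢ (^-monoʳ-< m 1<m k<n) m^k≡m^n)
... | tri≈ _ k≡n _ = k≡n
... | tri> _ _ n<k = ⊥-elim (<⇒≢ (^-monoʳ-< m 1<m n<k) (sym m^k≡m^n))

injection⇒≤length : ∀ {A : Set} {m} {ys : List A} (g : Fin m → A) →
                    (∀ {i j} → g i ≡ g j → i ≡ j) → (∀ i → g i ∈ ys) → m ℕ.≤ length ys
injection⇒≤length g g-injective g∈ys =
  injective⇒≤ (λ same → g-injective (index-injective (≡.setoid _) (g∈ys _) (g∈ys _) same))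

lookup-injective : ∀ {A : Set} {xs : List.List A} → Unique xs →
                   ∀ {i j} → List.lookup xs i ≡ List.lookup xs j → i ≡ j
lookup-injective (_ ∷ _)  {zero}  {zero}  _    = refl
lookup-injective (x∉ ∷ _) {zero}  {suc j} same = ⊥-elim (All.lookup x∉ (∈-lookup j) same)
lookup-injective (x∉ ∷ _) {suc i} {zero}  same = ⊥-elim (All.lookup x∉ (∈-lookup i) (sym same))
lookup-injective (_ ∷ u)  {suc i} {suc j} same = cong suc (lookup-injective u same)

module FieldProperties (K : FiniteField) where
  open FiniteField K
  open FieldDefs K

  commutativeRing : CommutativeRing _ _
  commutativeRing = record { isCommutativeRing = isCommutativeRing }

  open CommutativeRing commutativeRing public
    using (+-assoc; +-comm; *-assoc; *-comm; +-identityˡ; +-identityʳ; *-identityˡ;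
           distribˡ; distribʳ; zeroˡ; zeroʳ; -‿inverseˡ; -‿inverseʳ)
  open CommutativeRing commutativeRing using (ring; +-abelianGroup; +-commutativeSemigroup)
  open AbelianGroupProperties +-abelianGroup public
    using (inverseʳ-unique; x∙y⁻¹≈ε⇒x≈y; xyx⁻¹≈y; //-rightDividesˡ; ⁻¹-involutive; ε⁻¹≈ε;
           ⁻¹-∙-comm)
    renaming (∙-cancelˡ to +-cancelˡ; ∙-cancelʳ to +-cancelʳ)
  open CommutativeSemigroupProperties +-commutativeSemigroup public
    using (xy∙z≈y∙xz) renaming (interchange to +-interchange)
  open RingProperties ring public using (-‿distribˡ-*; -‿distribʳ-*; x+x≈x⇒x≈0)

  open ≡-Reasoning

  x*y≡0⇒x≡0∨y≡0 : ∀ x y → x * y ≡ 0# → x ≡ 0# ⊎ y ≡ 0#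
  x*y≡0⇒x≡0∨y≡0 x y xy≡0 with x ≟ 0#
  ... | yes x≡0 = inj₁ x≡0
  ... | no x≢0 with inverse x x≢0
  ...   | x⁻¹ , xx⁻¹≡1 = inj₂ (begin
    y              ≡⟨ sym (*-identityˡ y) ⟩
    1# * y         ≡⟨ cong (_* y) (trans (sym xx⁻¹≡1) (*-comm x x⁻¹)) ⟩
    (x⁻¹ * x) * y  ≡⟨ *-assoc x⁻¹ x y ⟩
    x⁻¹ * (x * y)  ≡⟨ cong (x⁻¹ *_) xy≡0 ⟩
    x⁻¹ * 0#       ≡⟨ zeroʳ x⁻¹ ⟩
    0#             ∎)

  smul-homo-+ : ∀ m n x → smul (m ℕ.+ n) x ≡ smul m x + smul n x
  smul-homo-+ zero    n x = sym (+-identityˡ _)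
  smul-homo-+ (suc m) n x = trans (cong (x +_) (smul-homo-+ m n x)) (sym (+-assoc x _ _))

  smul-assoc : ∀ m n x → smul (m ℕ.* n) x ≡ smul m (smul n x)
  smul-assoc zero    n x = refl
  smul-assoc (suc m) n x = trans (smul-homo-+ n (m ℕ.* n) x) (cong (smul n x +_) (smul-assoc m n x))

  smul-distrib-+ : ∀ n x y → smul n (x + y) ≡ smul n x + smul n y
  smul-distrib-+ zero    x y = sym (+-identityʳ 0#)
  smul-distrib-+ (suc n) x y = trans (cong ((x + y) +_) (smul-distrib-+ n x y)) (+-interchange x y _ _)

  smul-zeroʳ : ∀ n → smul n 0# ≡ 0#
  smul-zeroʳ zero    = refl
  smul-zeroʳ (suc n) = trans (+-identityˡ _) (smul-zeroʳ n)

  smul-identityˡ : ∀ x → smul 1 x ≡ x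
  smul-identityˡ = +-identityʳ

  smul-assoc-* : ∀ n x y → smul n (x * y) ≡ smul n x * y
  smul-assoc-* zero    x y = sym (zeroˡ y)
  smul-assoc-* (suc n) x y = trans (cong (x * y +_) (smul-assoc-* n x y)) (sym (distribʳ y x _))

  smul≡smul1#* : ∀ n x → smul n x ≡ smul n 1# * x
  smul≡smul1#* n x = trans (cong (smul n) (sym (*-identityˡ x))) (smul-assoc-* n 1# x)

  smul1#-homo-* : ∀ m n → smul (m ℕ.* n) 1# ≡ smul m 1# * smul n 1#
  smul1#-homo-* m n = trans (smul-assoc m n 1#) (smul≡smul1#* m (smul n 1#))

  smul-cancel : ∀ m n x → m ℕ.≤ n → smul n x ≡ smul m x → smul (n ∸ m) x ≡ 0#
  smul-cancel m n x m≤n nx≡mx = +-cancelʳ (smul m x) _ _ (begin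
    smul (n ∸ m) x + smul m x  ≡⟨ sym (smul-homo-+ (n ∸ m) m x) ⟩
    smul (n ∸ m ℕ.+ m) x       ≡⟨ cong (λ k → smul k x) (m∸n+n≡m m≤n) ⟩
    smul n x                   ≡⟨ nx≡mx ⟩
    smul m x                   ≡⟨ sym (+-identityˡ _) ⟩
    0# + smul m x              ∎)

  position : Carrier → Fin (length elems)
  position x = Any.index (elems-complete x)

  position-injective : ∀ {x y} → position x ≡ position y → y ≡ x
  position-injective {x} {y} same =
    sym (index-injective (≡.setoid Carrier) (elems-complete x) (elems-complete y) same)

  some-multiple-of-1#-vanishes : Σ ℕ λ m → 0 < m × smul m 1# ≡ 0#
  some-multiple-of-1#-vanishes
    with i , j , i<j , same ← pigeonhole (n<1+n (length elems)) (λ i → position (smul (toℕ i) 1#))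
    = toℕ j ∸ toℕ i , m<n⇒0<n∸m i<j
    , smul-cancel (toℕ i) (toℕ j) 1# (<⇒≤ i<j) (position-injective same)

  prime-characteristic : Σ ℕ λ q → Prime q × smul q 1# ≡ 0#
  prime-characteristic with m , 0<m , m1#≡0 ← some-multiple-of-1#-vanishes = <-rec Goal step m 0<m m1#≡0
    where
    Goal : ℕ → Set
    Goal m = 0 < m → smul m 1# ≡ 0# → Σ ℕ λ q → Prime q × smul q 1# ≡ 0#
    -- a vanishing multiple of 1# splits into a vanishing multiple of one of its factors
    step : ∀ m → (∀ {k} → k < m → Goal k) → Goal m
    step (suc zero) _ _ 1#≡0 = ⊥-elim (0≢1 (sym (trans (sym (+-identityʳ 1#)) 1#≡0)))
    step m@(suc (suc _)) rec _ m1#≡0 with prime? m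
    ... | yes pr = m , pr , m1#≡0
    ... | no ¬pr with ¬prime⇒composite ¬pr
    ...   | composite {d} d<m (divides e m≡e*d)
      with x*y≡0⇒x≡0∨y≡0 (smul e 1#) (smul d 1#)
             (trans (sym (smul1#-homo-* e d)) (trans (cong (λ k → smul k 1#) (sym m≡e*d)) m1#≡0))
    ...     | inj₂ d1#≡0 = rec d<m (<-trans (s≤s z≤n) 1<d) d1#≡0
      where
      1<d : 1 < d
      1<d = ℕ.nonTrivial⇒n>1 d
    ...     | inj₁ e1#≡0 = rec e<m (ℕ.n≢0⇒n>0 e≢0) e1#≡0
      where
      e≢0 : e ≢ 0
      e≢0 refl = case m≡e*d of λ ()
      e<m : e < m
      e<m = subst (e <_) (sym m≡e*d) (m<m*n e d {{ℕ.≢-nonZero e≢0}} (ℕ.nonTrivial⇒n>1 d))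

module PrimeCharacteristic (K : FiniteField) {p : ℕ} (p-prime : Prime p)
  (char : FieldDefs.smul K p (FiniteField.1# K) ≡ FiniteField.0# K) where
  open FiniteField K
  open FieldDefs K
  open FieldProperties K
  open ≡-Reasoning

  instance
    p-nonZero : ℕ.NonZero p
    p-nonZero = prime⇒nonZero p-prime

  smul-char : ∀ x → smul p x ≡ 0#
  smul-char x = trans (smul≡smul1#* p x) (trans (cong (_* x) char) (zeroˡ x))

  smul-multiple : ∀ k x → smul (k ℕ.* p) x ≡ 0#
  smul-multiple k x = trans (smul-assoc k p x) (trans (cong (smul k) (smul-char x)) (smul-zeroʳ k))

  smul-mod : ∀ i x → smul i x ≡ smul (i % p) x
  smul-mod i x = begin
    smul i x                                ≡⟨ cong (λ k → smul k x) (m≡m%n+[m/n]*n i p) ⟩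
    smul (i % p ℕ.+ (i / p) ℕ.* p) x        ≡⟨ smul-homo-+ (i % p) _ x ⟩
    smul (i % p) x + smul ((i / p) ℕ.* p) x ≡⟨ cong (smul (i % p) x +_) (smul-multiple (i / p) x) ⟩
    smul (i % p) x + 0#                     ≡⟨ +-identityʳ _ ⟩
    smul (i % p) x                          ∎

  smul-complement : ∀ i x → i ℕ.≤ p → smul (p ∸ i) x ≡ - smul i x
  smul-complement i x i≤p = inverseʳ-unique (smul i x) (smul (p ∸ i) x) (begin
    smul i x + smul (p ∸ i) x ≡⟨ sym (smul-homo-+ i (p ∸ i) x) ⟩
    smul (i ℕ.+ (p ∸ i)) x    ≡⟨ cong (λ k → smul k x) (m+[n∸m]≡n i≤p) ⟩
    smul p x                  ≡⟨ smul-char x ⟩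
    0#                        ∎)

  smul-inverse : ∀ {s} → 0 < s → s < p → Σ ℕ λ t → ∀ x → smul t (smul s x) ≡ x
  smul-inverse {s} 0<s s<p
    with coprime-Bézout (Coprime.sym (prime⇒coprime p-prime {{ℕ.>-nonZero 0<s}} s<p))
  ... | Bézout.+- t u 1+up≡ts = t , λ x → begin
    smul t (smul s x)        ≡⟨ sym (smul-assoc t s x) ⟩
    smul (t ℕ.* s) x         ≡⟨ cong (λ k → smul k x) (sym 1+up≡ts) ⟩
    smul (1 ℕ.+ u ℕ.* p) x   ≡⟨ smul-homo-+ 1 (u ℕ.* p) x ⟩
    smul 1 x + smul (u ℕ.* p) x ≡⟨ cong₂ _+_ (smul-identityˡ x) (smul-multiple u x) ⟩
    x + 0#                   ≡⟨ +-identityʳ x ⟩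
    x                        ∎
  ... | Bézout.-+ t u 1+ts≡up = (p ∸ 1) ℕ.* t , λ x → begin
    smul ((p ∸ 1) ℕ.* t) (smul s x) ≡⟨ smul-assoc (p ∸ 1) t _ ⟩
    smul (p ∸ 1) (smul t (smul s x)) ≡⟨ cong (smul (p ∸ 1)) (sym (smul-assoc t s x)) ⟩
    smul (p ∸ 1) (smul (t ℕ.* s) x) ≡⟨ cong (smul (p ∸ 1)) (ts≡-1 x) ⟩
    smul (p ∸ 1) (- x)              ≡⟨ smul-complement 1 (- x) (<⇒≤ (prime>1 p-prime)) ⟩
    - smul 1 (- x)                  ≡⟨ cong -_ (smul-identityˡ (- x)) ⟩
    - (- x)                         ≡⟨ ⁻¹-involutive x ⟩
    x                               ∎
    where
    ts≡-1 : ∀ x → smul (t ℕ.* s) x ≡ - x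
    ts≡-1 x = inverseʳ-unique x (smul (t ℕ.* s) x) (begin
      x + smul (t ℕ.* s) x        ≡⟨ cong (_+ smul (t ℕ.* s) x) (sym (smul-identityˡ x)) ⟩
      smul 1 x + smul (t ℕ.* s) x ≡⟨ sym (smul-homo-+ 1 (t ℕ.* s) x) ⟩
      smul (1 ℕ.+ t ℕ.* s) x      ≡⟨ cong (λ k → smul k x) 1+ts≡up ⟩
      smul (u ℕ.* p) x            ≡⟨ smul-multiple u x ⟩
      0#                          ∎)

  smul≡0⇒≡0 : ∀ {s} x → 0 < s → s < p → smul s x ≡ 0# → x ≡ 0#
  smul≡0⇒≡0 x 0<s s<p sx≡0 with t , inverse-t ← smul-inverse 0<s s<p =
    trans (sym (inverse-t x)) (trans (cong (smul t) sx≡0) (smul-zeroʳ t))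

  smul-injective : ∀ {i j x} → i < p → j < p → x ≢ 0# → smul i x ≡ smul j x → i ≡ j
  smul-injective {i} {j} {x} i<p j<p x≢0 ix≡jx with <-cmp i j
  ... | tri≈ _ i≡j _ = i≡j
  ... | tri< i<j _ _ = ⊥-elim (x≢0 (smul≡0⇒≡0 x (m<n⇒0<n∸m i<j) (≤-<-trans (m∸n≤m j i) j<p)
                                     (smul-cancel i j x (<⇒≤ i<j) (sym ix≡jx))))
  ... | tri> _ _ j<i = ⊥-elim (x≢0 (smul≡0⇒≡0 x (m<n⇒0<n∸m j<i) (≤-<-trans (m∸n≤m i j) i<p)
                                     (smul-cancel j i x (<⇒≤ j<i) ix≡jx)))

  smul≡0⇒coefficient≡0 : ∀ {c x} → c < p → x ≢ 0# → smul c x ≡ 0# → c ≡ 0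
  smul≡0⇒coefficient≡0 c<p x≢0 cx≡0 = smul-injective c<p (ℕ.n≢0⇒n>0 (ℕ.≢-nonZero⁻¹ p)) x≢0 cx≡0

  lc : ∀ {k} → Vec ℕ k → Vec Carrier k → Carrier
  lc []       []       = 0#
  lc (c ∷ cs) (b ∷ bs) = smul c b + lc cs bs

  Bounded : ∀ {k} → Vec ℕ k → Set
  Bounded c = ∀ i → lookup c i < p

  Independent : ∀ {k} → Vec Carrier k → Set
  Independent bs = ∀ c → Bounded c → lc c bs ≡ 0# → ∀ i → lookup c i ≡ 0

  Spanning : ∀ {k} → Vec Carrier k → Set
  Spanning {k} bs = ∀ x → Σ (Vec ℕ k) λ c → x ≡ lc c bs

  IsBasis : ∀ {k} → Vec Carrier k → Set
  IsBasis bs = Independent bs × Spanning bs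

  lc-smul : ∀ {k} t (c : Vec ℕ k) bs → smul t (lc c bs) ≡ lc (Vec.map (t ℕ.*_) c) bs
  lc-smul t []       []       = smul-zeroʳ t
  lc-smul t (c ∷ cs) (b ∷ bs) =
    trans (smul-distrib-+ t _ _) (cong₂ _+_ (sym (smul-assoc t c b)) (lc-smul t cs bs))

  lc-neg : ∀ {k} (c : Vec ℕ k) bs → Bounded c → - lc c bs ≡ lc (Vec.map (p ∸_) c) bs
  lc-neg []       []       _   = ε⁻¹≈ε
  lc-neg (c ∷ cs) (b ∷ bs) c<p = trans (sym (⁻¹-∙-comm _ _))
    (cong₂ _+_ (sym (smul-complement c b (<⇒≤ (c<p zero)))) (lc-neg cs bs (c<p ∘ suc)))

  reduce : ∀ {k} → Vec ℕ k → Vec ℕ k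
  reduce = Vec.map (_% p)

  reduce-bounded : ∀ {k} (c : Vec ℕ k) → Bounded (reduce c)
  reduce-bounded c i = subst (_< p) (sym (lookup-map i (_% p) c)) (m%n<n (lookup c i) p)

  lc-reduce : ∀ {k} (c : Vec ℕ k) bs → lc (reduce c) bs ≡ lc c bs
  lc-reduce []       []       = refl
  lc-reduce (c ∷ cs) (b ∷ bs) = cong₂ _+_ (sym (smul-mod c b)) (lc-reduce cs bs)

  _⊖_ : ℕ → ℕ → ℕ
  a ⊖ b = (a ℕ.+ (p ∸ b)) % p

  smul-⊖ : ∀ a b x → b ℕ.≤ p → smul (a ⊖ b) x ≡ smul a x + - smul b x
  smul-⊖ a b x b≤p = begin
    smul (a ⊖ b) x                 ≡⟨ sym (smul-mod (a ℕ.+ (p ∸ b)) x) ⟩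
    smul (a ℕ.+ (p ∸ b)) x         ≡⟨ smul-homo-+ a (p ∸ b) x ⟩
    smul a x + smul (p ∸ b) x      ≡⟨ cong (smul a x +_) (smul-complement b x b≤p) ⟩
    smul a x + - smul b x          ∎

  lc-⊖ : ∀ {k} (c d : Vec ℕ k) bs → Bounded d → lc (zipWith _⊖_ c d) bs ≡ lc c bs + - lc d bs
  lc-⊖ []       []       []       _   = sym (-‿inverseʳ 0#)
  lc-⊖ (c ∷ cs) (d ∷ ds) (b ∷ bs) d<p = begin
    smul (c ⊖ d) b + lc (zipWith _⊖_ cs ds) bs
      ≡⟨ cong₂ _+_ (smul-⊖ c d b (<⇒≤ (d<p zero))) (lc-⊖ cs ds bs (d<p ∘ suc)) ⟩
    (smul c b + - smul d b) + (lc cs bs + - lc ds bs)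
      ≡⟨ +-interchange _ _ _ _ ⟩
    (smul c b + lc cs bs) + (- smul d b + - lc ds bs)
      ≡⟨ cong ((smul c b + lc cs bs) +_) (⁻¹-∙-comm _ _) ⟩
    (smul c b + lc cs bs) + - (smul d b + lc ds bs) ∎

  lc-injective : ∀ {k} {bs : Vec Carrier k} → Independent bs →
                 ∀ {c d} → Bounded c → Bounded d → lc c bs ≡ lc d bs → c ≡ d
  lc-injective {bs = bs} independent {c} {d} c<p d<p same =
    trans (sym (tabulate∘lookup c)) (trans (tabulate-cong same-at) (tabulate∘lookup d))
    where
    difference≡0 : lc (zipWith _⊖_ c d) bs ≡ 0#
    difference≡0 = trans (lc-⊖ c d bs d<p) (trans (cong (_+ - lc d bs) same) (-‿inverseʳ _))
    same-at : ∀ i → lookup c i ≡ lookup d i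
    same-at i = smul-injective (c<p i) (d<p i) (0≢1 ∘ sym) (x∙y⁻¹≈ε⇒x≈y _ _ (begin
      smul (lookup c i) 1# + - smul (lookup d i) 1#  ≡⟨ sym (smul-⊖ _ _ 1# (<⇒≤ (d<p i))) ⟩
      smul (lookup c i ⊖ lookup d i) 1#
        ≡⟨ cong (λ k → smul k 1#) (sym (lookup-zipWith _⊖_ i c d)) ⟩
      smul (lookup (zipWith _⊖_ c d) i) 1#
        ≡⟨ cong (λ k → smul k 1#) (independent (zipWith _⊖_ c d) ⊖-bounded difference≡0 i) ⟩
      0#                                             ∎))
      where
      ⊖-bounded : Bounded (zipWith _⊖_ c d)
      ⊖-bounded j = subst (_< p) (sym (lookup-zipWith _⊖_ j c d)) (m%n<n _ p)

  decode : ∀ {k} → Fin (p ^ k) → Vec ℕ k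
  decode {k} i = tabulate (λ j → toℕ (finToFun {p} {k} i j))

  encode : ∀ {k} (c : Vec ℕ k) → Bounded c → Fin (p ^ k)
  encode {k} c c<p = funToFin {k} {p} (λ j → fromℕ< (c<p j))

  decode-bounded : ∀ {k} (i : Fin (p ^ k)) → Bounded (decode i)
  decode-bounded {k} i j = subst (_< p) (sym (lookup∘tabulate _ j)) (toℕ<n (finToFun {p} {k} i j))

  decode-encode : ∀ {k} (c : Vec ℕ k) (c<p : Bounded c) → decode (encode c c<p) ≡ c
  decode-encode {k} c c<p = trans (tabulate-cong at) (tabulate∘lookup c)
    where
    at : ∀ j → toℕ (finToFun {p} {k} (encode c c<p) j) ≡ lookup c j
    at j = trans (cong toℕ (finToFun-funToFin {k} {p} _ j)) (toℕ-fromℕ< (c<p j))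

  funToFin-cong : ∀ {m n} {f g : Fin m → Fin n} → (∀ j → f j ≡ g j) → funToFin f ≡ funToFin g
  funToFin-cong {zero}  _   = refl
  funToFin-cong {suc m} f≗g = cong₂ combine (f≗g zero) (funToFin-cong (f≗g ∘ suc))

  decode-injective : ∀ {k} {i j : Fin (p ^ k)} → decode i ≡ decode j → i ≡ j
  decode-injective {k} {i} {j} same = begin
    i                               ≡⟨ sym (funToFin-finToFin {k} {p} i) ⟩
    funToFin (finToFun {p} {k} i)   ≡⟨ funToFin-cong (λ l → toℕ-injective (at l)) ⟩
    funToFin (finToFun {p} {k} j)   ≡⟨ funToFin-finToFin {k} {p} j ⟩
    j                               ∎
    where
    at : ∀ l → toℕ (finToFun {p} {k} i l) ≡ toℕ (finToFun {p} {k} j l)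
    at l = trans (sym (lookup∘tabulate _ l)) (trans (cong (λ v → lookup v l) same) (lookup∘tabulate _ l))

  independent⇒p^k≤card : ∀ {k} {bs : Vec Carrier k} → Independent bs → p ^ k ℕ.≤ length elems
  independent⇒p^k≤card {k} {bs} independent = injective⇒≤ {f = λ i → position (lc (decode i) bs)}
    λ {i} {j} same → decode-injective
      (lc-injective independent (decode-bounded i) (decode-bounded j) (sym (position-injective same)))

  spanning⇒card≤p^k : ∀ {k} {bs : Vec Carrier k} → Spanning bs → length elems ℕ.≤ p ^ k
  spanning⇒card≤p^k {k} {bs} spanning = injective⇒≤ {f = code ∘ List.lookup elems}
    λ {i} {j} same → lookup-injective elems-unique (begin
      List.lookup elems i  ≡⟨ coordinates-correct _ ⟩
      lc (coordinates (List.lookup elems i)) bs  ≡⟨ cong (λ c → lc c bs) (coordinates-injective same) ⟩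
      lc (coordinates (List.lookup elems j)) bs  ≡⟨ sym (coordinates-correct _) ⟩
      List.lookup elems j  ∎)
    where
    coordinates : Carrier → Vec ℕ k
    coordinates x = reduce (proj₁ (spanning x))
    coordinates-bounded : ∀ x → Bounded (coordinates x)
    coordinates-bounded x = reduce-bounded (proj₁ (spanning x))
    coordinates-correct : ∀ x → x ≡ lc (coordinates x) bs
    coordinates-correct x = trans (proj₂ (spanning x)) (sym (lc-reduce (proj₁ (spanning x)) bs))
    code : Carrier → Fin (p ^ k)
    code x = encode (coordinates x) (coordinates-bounded x)
    coordinates-injective : ∀ {x y} → code x ≡ code y → coordinates x ≡ coordinates y
    coordinates-injective {x} {y} same = trans (sym (decode-encode _ (coordinates-bounded x)))
      (trans (cong decode same) (decode-encode _ (coordinates-bounded y)))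

  InSpan : ∀ {k} → Vec Carrier k → Carrier → Set
  InSpan {k} bs x = Σ (Fin (p ^ k)) λ i → x ≡ lc (decode i) bs

  inSpan? : ∀ {k} (bs : Vec Carrier k) x → Dec (InSpan bs x)
  inSpan? bs x = any? (λ i → x ≟ lc (decode i) bs)

  ¬InSpan⇒≢lc : ∀ {k} {bs : Vec Carrier k} {x} → ¬ InSpan bs x → ∀ c → x ≢ lc c bs
  ¬InSpan⇒≢lc {bs = bs} x∉span c x≡lc = x∉span (encode (reduce c) (reduce-bounded c) , (begin
    _                                               ≡⟨ x≡lc ⟩
    lc c bs                                         ≡⟨ sym (lc-reduce c bs) ⟩
    lc (reduce c) bs
      ≡⟨ cong (λ v → lc v bs) (sym (decode-encode (reduce c) (reduce-bounded c))) ⟩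
    lc (decode (encode (reduce c) (reduce-bounded c))) bs ∎))

  independent-∷ : ∀ {k} {bs : Vec Carrier k} {x} → Independent bs → (∀ c → x ≢ lc c bs) →
                  Independent (x ∷ bs)
  independent-∷ independent x∉span (zero ∷ cs) c<p lc≡0 zero    = refl
  independent-∷ independent x∉span (zero ∷ cs) c<p lc≡0 (suc i) =
    independent cs (c<p ∘ suc) (trans (sym (+-identityˡ _)) lc≡0) i
  independent-∷ {bs = bs} {x} independent x∉span (suc c ∷ cs) c<p lc≡0 i
    with t , inverse-t ← smul-inverse (s≤s z≤n) (c<p zero)
    = ⊥-elim (x∉span (Vec.map (t ℕ.*_) (Vec.map (p ∸_) cs)) (begin
      x                                     ≡⟨ sym (inverse-t x) ⟩
      smul t (smul (suc c) x)               ≡⟨ cong (smul t) (inverseʳ-unique _ _ (trans (+-comm _ _) lc≡0)) ⟩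
      smul t (- lc cs bs)                   ≡⟨ cong (smul t) (lc-neg cs bs (c<p ∘ suc)) ⟩
      smul t (lc (Vec.map (p ∸_) cs) bs)    ≡⟨ lc-smul t (Vec.map (p ∸_) cs) bs ⟩
      lc (Vec.map (t ℕ.*_) (Vec.map (p ∸_) cs)) bs ∎))

  -- The fuel cannot run out: an independent family of k vectors has p ^ k ≤ |K|, and k < p ^ k.
  basis-extending : ∀ fuel {k} (bs : Vec Carrier k) → Independent bs → k ℕ.+ fuel ≡ length elems →
                    Σ ℕ λ m → Σ (Vec Carrier m) IsBasis
  basis-extending fuel bs independent _ with All.all? (inSpan? bs) elems
  ... | yes allInSpan = _ , bs , independent , λ x →
    let (i , x≡) = All.lookup allInSpan (elems-complete x) in decode i , x≡
  basis-extending zero {k} bs independent k+0≡card | no _ =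
    ⊥-elim (<⇒≱ (n<m^n (prime>1 p-prime) k)
      (subst (p ^ k ℕ.≤_) (trans (sym k+0≡card) (ℕ.+-identityʳ k)) (independent⇒p^k≤card independent)))
  basis-extending (suc fuel) {k} bs independent k+1+fuel≡card | no notAllInSpan
    with x , x∉span ← Any.satisfied (¬All⇒Any¬ (inSpan? bs) elems notAllInSpan)
    = basis-extending fuel (x ∷ bs) (independent-∷ independent (¬InSpan⇒≢lc x∉span))
                      (trans (sym (+-suc k fuel)) k+1+fuel≡card)

  basis : Σ ℕ λ k → Σ (Vec Carrier k) IsBasis
  basis = basis-extending (length elems) [] (λ { [] _ _ () }) refl

  basis-card : ∀ {k} {bs : Vec Carrier k} → IsBasis bs → length elems ≡ p ^ k
  basis-card (independent , spanning) =
    ≤-antisym (spanning⇒card≤p^k spanning) (independent⇒p^k≤card independent)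

characteristic : (K : FiniteField) → ∀ {p n} → Prime p → 1 ℕ.≤ n →
                 length (FiniteField.elems K) ≡ p ^ n →
                 FieldDefs.smul K p (FiniteField.1# K) ≡ FiniteField.0# K
characteristic K {p} {n} p-prime 1≤n card
  with q , q-prime , q-char ← FieldProperties.prime-characteristic K
  with k , _ , isBasis ← PrimeCharacteristic.basis K q-prime q-char
  = subst (λ r → FieldDefs.smul K r (FiniteField.1# K) ≡ FiniteField.0# K)
      (prime-power-base-unique {k = k} {n} q-prime p-prime 1≤n
        (trans (sym (PrimeCharacteristic.basis-card K q-prime q-char isBasis)) card))
      q-char

module Brackets (K : FiniteField) where
  open FiniteField K
  open FieldDefs K
  open FieldProperties K
  open ≡-Reasoning

  Σl-++ : ∀ xs ys → Σl (xs List.++ ys) ≡ Σl xs + Σl ys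
  Σl-++ []       ys = sym (+-identityˡ _)
  Σl-++ (x ∷ xs) ys = trans (cong (x +_) (Σl-++ xs ys)) (sym (+-assoc x _ _))

  Σl-applyUpTo-cong : ∀ {g g′ : ℕ → Carrier} m → (∀ j → g j ≡ g′ j) →
                      Σl (List.applyUpTo g m) ≡ Σl (List.applyUpTo g′ m)
  Σl-applyUpTo-cong zero    _    = refl
  Σl-applyUpTo-cong (suc m) g≗g′ = cong₂ _+_ (g≗g′ 0) (Σl-applyUpTo-cong m (g≗g′ ∘ suc))

  signedSum : (List Carrier → Carrier) → ℕ → List (List Carrier) → Carrier
  signedSum g n Is = Σl (List.map (λ I → sign (n ∸ length I) * g I) Is)

  signedSum-suc : ∀ g n Is → All.All (λ I → length I ℕ.≤ n) Is →
                  signedSum g (suc n) Is ≡ - signedSum g n Is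
  signedSum-suc g n []       _                 = sym ε⁻¹≈ε
  signedSum-suc g n (I ∷ Is) (|I|≤n All.∷ |Is|≤n) = begin
    sign (suc n ∸ length I) * g I + signedSum g (suc n) Is
      ≡⟨ cong₂ _+_ (cong (λ k → sign k * g I) (+-∸-assoc 1 |I|≤n)) (signedSum-suc g n Is |Is|≤n) ⟩
    (- sign (n ∸ length I)) * g I + - signedSum g n Is
      ≡⟨ cong (_+ - signedSum g n Is) (sym (-‿distribˡ-* _ _)) ⟩
    - (sign (n ∸ length I) * g I) + - signedSum g n Is
      ≡⟨ ⁻¹-∙-comm _ _ ⟩
    - (sign (n ∸ length I) * g I + signedSum g n Is) ∎

  subsets-length : ∀ (ys : List Carrier) → All.All (λ I → length I ℕ.≤ length ys) (subsets ys)
  subsets-length []       = ℕ.≤-refl All.∷ All.[]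
  subsets-length (y ∷ ys) =
    ++⁺ (map⁺ (All.map s≤s (subsets-length ys))) (All.map ℕ.m≤n⇒m≤1+n (subsets-length ys))

  bracket-∷ : ∀ f y ys → bracket f (y ∷ ys) ≡ bracket (λ z → f (y + z)) ys + - bracket f ys
  bracket-∷ f y ys = begin
    signedSum (f ∘ Σl) (suc n) (List.map (y ∷_) (subsets ys) List.++ subsets ys)
      ≡⟨ cong Σl (List.map-++ _ (List.map (y ∷_) (subsets ys)) (subsets ys)) ⟩
    Σl (List.map _ (List.map (y ∷_) (subsets ys)) List.++ List.map _ (subsets ys))
      ≡⟨ Σl-++ (List.map _ (List.map (y ∷_) (subsets ys))) _ ⟩
    signedSum (f ∘ Σl) (suc n) (List.map (y ∷_) (subsets ys)) + signedSum (f ∘ Σl) (suc n) (subsets ys)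
      ≡⟨ cong₂ _+_ (cong Σl (sym (List.map-∘ (subsets ys))))
                   (signedSum-suc (f ∘ Σl) n (subsets ys) (subsets-length ys)) ⟩
    bracket (λ z → f (y + z)) ys + - bracket f ys ∎
    where n = length ys

module FiniteDifferences (K : FiniteField) {p : ℕ} (p-prime : Prime p)
  (char : FieldDefs.smul K p (FiniteField.1# K) ≡ FiniteField.0# K) (d : FiniteField.Carrier K) where
  open FiniteField K
  open FieldDefs K
  open FieldProperties K
  open PrimeCharacteristic K p-prime char using (smul-multiple)
  open Brackets K using (bracket-∷; Σl-applyUpTo-cong)
  open ≡-Reasoning

  -- weighted h c m = Σ_{i<m} c i * h (i·d)
  weighted : (Carrier → Carrier) → (ℕ → Carrier) → ℕ → Carrier
  weighted h c zero    = 0#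
  weighted h c (suc m) = c 0 * h 0# + weighted (λ z → h (d + z)) (c ∘ suc) m

  shift : (ℕ → Carrier) → ℕ → Carrier
  shift c zero    = 0#
  shift c (suc i) = c i

  weighted-cong : ∀ h {c c′} m → (∀ i → i < m → c i ≡ c′ i) → weighted h c m ≡ weighted h c′ m
  weighted-cong h zero    _    = refl
  weighted-cong h (suc m) c≗c′ =
    cong₂ _+_ (cong (_* h 0#) (c≗c′ 0 (s≤s z≤n))) (weighted-cong _ m (λ i i<m → c≗c′ (suc i) (s≤s i<m)))

  weighted-sub : ∀ h c c′ m → weighted h c m + - weighted h c′ m ≡ weighted h (λ i → c i + - c′ i) m
  weighted-sub h c c′ zero    = trans (cong (0# +_) ε⁻¹≈ε) (+-identityʳ 0#)
  weighted-sub h c c′ (suc m) = begin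
    (c 0 * h 0# + W) + - (c′ 0 * h 0# + W′)
      ≡⟨ cong ((c 0 * h 0# + W) +_) (sym (⁻¹-∙-comm _ _)) ⟩
    (c 0 * h 0# + W) + (- (c′ 0 * h 0#) + - W′)
      ≡⟨ +-interchange _ _ _ _ ⟩
    (c 0 * h 0# + - (c′ 0 * h 0#)) + (W + - W′)
      ≡⟨ cong₂ _+_ (trans (cong (c 0 * h 0# +_) (-‿distribˡ-* _ _)) (sym (distribʳ (h 0#) (c 0) (- c′ 0))))
                   (weighted-sub _ (c ∘ suc) (c′ ∘ suc) m) ⟩
    (c 0 + - c′ 0) * h 0# + weighted _ (λ i → c (suc i) + - c′ (suc i)) m ∎
    where
    W W′ : Carrier
    W  = weighted (λ z → h (d + z)) (c ∘ suc) m
    W′ = weighted (λ z → h (d + z)) (c′ ∘ suc) m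

  weighted-extend : ∀ h c m → c m ≡ 0# → weighted h c (suc m) ≡ weighted h c m
  weighted-extend h c zero    c0≡0 =
    trans (cong (λ t → t * h 0# + 0#) c0≡0) (trans (+-identityʳ _) (zeroˡ (h 0#)))
  weighted-extend h c (suc m) cm≡0 = cong (c 0 * h 0# +_) (weighted-extend _ (c ∘ suc) m cm≡0)

  weighted-shift : ∀ h c m → weighted h (shift c) (suc m) ≡ weighted (λ z → h (d + z)) c m
  weighted-shift h c m = trans (cong (_+ weighted (λ z → h (d + z)) c m) (zeroˡ (h 0#))) (+-identityˡ _)

  weighted-ones : ∀ h m → weighted h (λ _ → 1#) m ≡ Σl (List.applyUpTo (λ j → h (smul j d)) m)
  weighted-ones h zero    = refl
  weighted-ones h (suc m) = cong₂ _+_ (*-identityˡ (h 0#)) (weighted-ones (λ z → h (d + z)) m)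

  -- the coefficient of h (i·d) in the k-th forward difference of h with step d
  coefficient : ℕ → ℕ → Carrier
  coefficient k i = sign (k ∸ i) * smul (k C i) 1#

  coefficient-top : ∀ k → coefficient k (suc k) ≡ 0#
  coefficient-top k = trans (cong (λ u → sign (k ∸ suc k) * smul u 1#) (k>n⇒nCk≡0 (n<1+n k))) (zeroʳ _)

  sign-pred : ∀ {k j} → j < k → sign (k ∸ j) ≡ - sign (k ∸ suc j)
  sign-pred {suc k} (s≤s j≤k) = cong sign (+-∸-assoc 1 j≤k)

  negate-next-term : ∀ k j →
                     - (sign (k ∸ suc j) * smul (k C suc j) 1#) ≡ sign (k ∸ j) * smul (k C suc j) 1#
  negate-next-term k j with j ℕ.<? k
  ... | yes j<k = trans (-‿distribˡ-* _ _) (cong (_* smul (k C suc j) 1#) (sym (sign-pred j<k)))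
  ... | no j≮k rewrite k>n⇒nCk≡0 (s≤s (ℕ.≮⇒≥ j≮k)) =
    trans (cong -_ (zeroʳ _)) (trans ε⁻¹≈ε (sym (zeroʳ _)))

  coefficient-pascal : ∀ k i → shift (coefficient k) i + - coefficient k i ≡ coefficient (suc k) i
  coefficient-pascal k zero    = trans (+-identityˡ _) (-‿distribˡ-* _ _)
  coefficient-pascal k (suc j) = begin
    sign (k ∸ j) * smul (k C j) 1# + - (sign (k ∸ suc j) * smul (k C suc j) 1#)
      ≡⟨ cong (sign (k ∸ j) * smul (k C j) 1# +_) (negate-next-term k j) ⟩
    sign (k ∸ j) * smul (k C j) 1# + sign (k ∸ j) * smul (k C suc j) 1#
      ≡⟨ sym (distribˡ _ _ _) ⟩
    sign (k ∸ j) * (smul (k C j) 1# + smul (k C suc j) 1#)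
      ≡⟨ cong (sign (k ∸ j) *_) (sym (smul-homo-+ (k C j) (k C suc j) 1#)) ⟩
    sign (k ∸ j) * smul (k C j ℕ.+ k C suc j) 1#
      ≡⟨ cong (λ u → sign (k ∸ j) * smul u 1#) (nCk+nC[k+1]≡[n+1]C[k+1] k j) ⟩
    sign (k ∸ j) * smul (suc k C suc j) 1# ∎

  bracket-replicate : ∀ k h → bracket h (replicate k d) ≡ weighted h (coefficient k) (suc k)
  bracket-replicate zero    h = cong (λ c → c * h 0# + 0#) (sym (trans (*-identityˡ _) (+-identityʳ 1#)))
  bracket-replicate (suc k) h = begin
    bracket h (d ∷ replicate k d)
      ≡⟨ bracket-∷ h d (replicate k d) ⟩
    bracket (λ z → h (d + z)) (replicate k d) + - bracket h (replicate k d)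
      ≡⟨ cong₂ (λ u v → u + - v) (bracket-replicate k (λ z → h (d + z))) (bracket-replicate k h) ⟩
    weighted (λ z → h (d + z)) (coefficient k) (suc k) + - weighted h (coefficient k) (suc k)
      ≡⟨ cong₂ (λ u v → u + - v) (sym (weighted-shift h (coefficient k) (suc k)))
                                 (sym (weighted-extend h (coefficient k) (suc k) (coefficient-top k))) ⟩
    weighted h (shift (coefficient k)) (2 ℕ.+ k) + - weighted h (coefficient k) (2 ℕ.+ k)
      ≡⟨ weighted-sub h (shift (coefficient k)) (coefficient k) (2 ℕ.+ k) ⟩
    weighted h (λ i → shift (coefficient k) i + - coefficient k i) (2 ℕ.+ k)
      ≡⟨ weighted-cong h (2 ℕ.+ k) (λ i _ → coefficient-pascal k i) ⟩
    weighted h (coefficient (suc k)) (2 ℕ.+ k) ∎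

  private
    m : ℕ
    m = p ∸ 1

    p≡1+m : p ≡ suc m
    p≡1+m = sym (ℕ.suc-pred p {{prime⇒nonZero p-prime}})

  -- (p−1 C i) ≡ (−1)^i mod p because (p−1 C i) + (p−1 C i+1) = p C i+1 ≡ 0, so the signs
  -- (−1)^(p−1−i) make all coefficients agree.
  coefficient-consecutive : ∀ i → suc i < p → coefficient m (suc i) ≡ coefficient m i
  coefficient-consecutive i 1+i<p = begin
    sign (m ∸ suc i) * smul (m C suc i) 1#     ≡⟨ cong (sign (m ∸ suc i) *_) next≡-this ⟩
    sign (m ∸ suc i) * - smul (m C i) 1#       ≡⟨ sym (-‿distribʳ-* _ _) ⟩
    - (sign (m ∸ suc i) * smul (m C i) 1#)     ≡⟨ -‿distribˡ-* _ _ ⟩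
    (- sign (m ∸ suc i)) * smul (m C i) 1#     ≡⟨ cong (_* smul (m C i) 1#) (sym (sign-pred i<m)) ⟩
    sign (m ∸ i) * smul (m C i) 1#             ∎
    where
    i<m : i < m
    i<m = ℕ.≤-pred (subst (suc i <_) p≡1+m 1+i<p)
    p∣pC[1+i] : p ∣ p C suc i
    p∣pC[1+i] = prime∣pCk p-prime (s≤s z≤n) 1+i<p
    next≡-this : smul (m C suc i) 1# ≡ - smul (m C i) 1#
    next≡-this with divides t pC[1+i]≡t*p ← p∣pC[1+i] = inverseʳ-unique _ _ (begin
      smul (m C i) 1# + smul (m C suc i) 1#  ≡⟨ sym (smul-homo-+ (m C i) (m C suc i) 1#) ⟩
      smul (m C i ℕ.+ m C suc i) 1#          ≡⟨ cong (λ u → smul u 1#) (nCk+nC[k+1]≡[n+1]C[k+1] m i) ⟩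
      smul (suc m C suc i) 1#                ≡⟨ cong (λ u → smul (u C suc i) 1#) (sym p≡1+m) ⟩
      smul (p C suc i) 1#                    ≡⟨ cong (λ u → smul u 1#) pC[1+i]≡t*p ⟩
      smul (t ℕ.* p) 1#                      ≡⟨ smul-multiple t 1# ⟩
      0#                                     ∎)

  coefficient-diagonal : coefficient m m ≡ 1#
  coefficient-diagonal =
    trans (cong₂ (λ k c → sign k * smul c 1#) (ℕ.n∸n≡0 m) (nCn≡1 m))
          (trans (*-identityˡ _) (+-identityʳ 1#))

  coefficient-char : ∀ i → i < p → coefficient m i ≡ 1#
  coefficient-char i i<p = descend (m ∸ i) i (m∸n+n≡m (ℕ.≤-pred (subst (i <_) p≡1+m i<p)))
    where
    descend : ∀ j i → j ℕ.+ i ≡ m → coefficient m i ≡ 1#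
    descend zero    i refl = coefficient-diagonal
    descend (suc j) i j+1+i≡m = trans (sym (coefficient-consecutive i 1+i<p))
                                      (descend j (suc i) (trans (+-suc j i) j+1+i≡m))
      where
      1+i<p : suc i < p
      1+i<p = subst (suc i <_) (sym p≡1+m)
                (s≤s (subst (suc i ℕ.≤_) j+1+i≡m (s≤s (ℕ.m≤n+m i j))))

  bracket-replicate-char : ∀ h → bracket h (replicate m d) ≡ Σl (List.applyUpTo (λ j → h (smul j d)) p)
  bracket-replicate-char h = begin
    bracket h (replicate m d)
      ≡⟨ bracket-replicate m h ⟩
    weighted h (coefficient m) (suc m)
      ≡⟨ weighted-cong h (suc m) (λ i i<1+m → coefficient-char i (subst (i <_) (sym p≡1+m) i<1+m)) ⟩
    weighted h (λ _ → 1#) (suc m)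
      ≡⟨ weighted-ones h (suc m) ⟩
    Σl (List.applyUpTo (λ j → h (smul j d)) (suc m))
      ≡⟨ cong (λ u → Σl (List.applyUpTo (λ j → h (smul j d)) u)) (sym p≡1+m) ⟩
    Σl (List.applyUpTo (λ j → h (smul j d)) p) ∎

  Dt≡Σl-applyUpTo : ∀ f x → Dt p f d x ≡ Σl (List.applyUpTo (λ j → f (x + smul j d)) p)
  Dt≡Σl-applyUpTo f x = cong Σl (List.map-upTo (λ j → f (x + smul j d)) p)

  Bt≡Dt-Dt0 : ∀ f x → Bt p f x d ≡ Dt p f d x + - Dt p f d 0#
  Bt≡Dt-Dt0 f x = begin
    bracket f (x ∷ replicate m d)
      ≡⟨ bracket-∷ f x (replicate m d) ⟩
    bracket (λ z → f (x + z)) (replicate m d) + - bracket f (replicate m d)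
      ≡⟨ cong₂ (λ u v → u + - v) (bracket-replicate-char (λ z → f (x + z)))
                                 (bracket-replicate-char f) ⟩
    Σl (List.applyUpTo (λ j → f (x + smul j d)) p) + - Σl (List.applyUpTo (λ j → f (smul j d)) p)
      ≡⟨ cong₂ (λ u v → u + - v) (sym (Dt≡Σl-applyUpTo f x))
           (trans (Σl-applyUpTo-cong p (λ j → cong f (sym (+-identityˡ _)))) (sym (Dt≡Σl-applyUpTo f 0#))) ⟩
    Dt p f d x + - Dt p f d 0# ∎

module GAPNKernel (K : FiniteField) {p : ℕ} (p-prime : Prime p)
  (char : FieldDefs.smul K p (FiniteField.1# K) ≡ FiniteField.0# K)
  (f : FiniteField.Carrier K → FiniteField.Carrier K) (gapn : FieldDefs.GAPN K p f)
  (d : FiniteField.Carrier K) where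
  open FiniteField K
  open FieldDefs K
  open FieldProperties K
  open PrimeCharacteristic K p-prime char using (p-nonZero; smul-char; smul-⊖; _⊖_; smul-injective)
  open Brackets K using (Σl-++; Σl-applyUpTo-cong)
  open FiniteDifferences K p-prime char d using (Dt≡Σl-applyUpTo; Bt≡Dt-Dt0)
  open ≡-Reasoning

  Σl-rotate : ∀ (g : ℕ → Carrier) m → g m ≡ g 0 →
              Σl (List.applyUpTo (g ∘ suc) m) ≡ Σl (List.applyUpTo g m)
  Σl-rotate g m gm≡g0 = +-cancelˡ (g 0) _ _ (begin
    g 0 + Σl (List.applyUpTo (g ∘ suc) m)           ≡⟨ cong Σl (sym (List.applyUpTo-∷ʳ g m)) ⟩
    Σl (List.applyUpTo g m List.++ List.[ g m ])    ≡⟨ Σl-++ (List.applyUpTo g m) List.[ g m ] ⟩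
    Σl (List.applyUpTo g m) + (g m + 0#)
      ≡⟨ cong (Σl (List.applyUpTo g m) +_) (trans (+-identityʳ (g m)) gm≡g0) ⟩
    Σl (List.applyUpTo g m) + g 0                   ≡⟨ +-comm _ (g 0) ⟩
    g 0 + Σl (List.applyUpTo g m)                   ∎)

  Dt-translate : ∀ x → Dt p f d (d + x) ≡ Dt p f d x
  Dt-translate x = begin
    Dt p f d (d + x)                                      ≡⟨ Dt≡Σl-applyUpTo f (d + x) ⟩
    Σl (List.applyUpTo (λ j → f ((d + x) + smul j d)) p)
      ≡⟨ Σl-applyUpTo-cong p (λ j → cong f (xy∙z≈y∙xz d x (smul j d))) ⟩
    Σl (List.applyUpTo (g ∘ suc) p)
      ≡⟨ Σl-rotate g p (cong (λ u → f (x + u)) (smul-char d)) ⟩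
    Σl (List.applyUpTo g p)                               ≡⟨ sym (Dt≡Σl-applyUpTo f x) ⟩
    Dt p f d x                                            ∎
    where
    g : ℕ → Carrier
    g j = f (x + smul j d)

  Dt-translate-multiple : ∀ j x → Dt p f d (smul j d + x) ≡ Dt p f d x
  Dt-translate-multiple zero    x = cong (Dt p f d) (+-identityˡ x)
  Dt-translate-multiple (suc j) x =
    trans (cong (Dt p f d) (+-assoc d (smul j d) x)) (trans (Dt-translate _) (Dt-translate-multiple j x))

  Bt-line : ∀ t → Bt p f (smul t d) d ≡ 0#
  Bt-line t = begin
    Bt p f (smul t d) d                      ≡⟨ Bt≡Dt-Dt0 f (smul t d) ⟩
    Dt p f d (smul t d) + - Dt p f d 0#      ≡⟨ cong (λ u → Dt p f d u + - Dt p f d 0#) (sym (+-identityʳ _)) ⟩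
    Dt p f d (smul t d + 0#) + - Dt p f d 0# ≡⟨ cong (_+ - Dt p f d 0#) (Dt-translate-multiple t 0#) ⟩
    Dt p f d 0# + - Dt p f d 0#              ≡⟨ -‿inverseʳ _ ⟩
    0#                                       ∎

  -- Off the line F_p·d, the two cosets F_p·d and x + F_p·d would give 2p solutions
  -- of D~_d f(y) = D~_d f(0), contradicting the GAPN bound.
  Bt-kernel : d ≢ 0# → ∀ x → Bt p f x d ≡ 0# → Σ ℕ λ t → t < p × x ≡ smul t d
  Bt-kernel d≢0 x Bt≡0 with any? (λ (t : Fin p) → x ≟ smul (toℕ t) d)
  ... | yes (t , x≡td) = toℕ t , toℕ<n t , x≡td
  ... | no x∉line = ⊥-elim (<⇒≱ (m<m+n p (ℕ.n≢0⇒n>0 (ℕ.≢-nonZero⁻¹ p)))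
    (ℕ.≤-trans (injection⇒≤length point point-injective point∈solutions) (gapn d (Dt p f d 0#) d≢0)))
    where
    point′ : Fin p ⊎ Fin p → Carrier
    point′ (inj₁ t) = smul (toℕ t) d
    point′ (inj₂ t) = x + smul (toℕ t) d
    point : Fin (p ℕ.+ p) → Carrier
    point = point′ ∘ splitAt p
    solves : ∀ i → Dt p f d (point i) ≡ Dt p f d 0#
    solves i with splitAt p i
    ... | inj₁ t = trans (cong (Dt p f d) (sym (+-identityʳ _))) (Dt-translate-multiple (toℕ t) 0#)
    ... | inj₂ t = trans (cong (Dt p f d) (+-comm x _)) (trans (Dt-translate-multiple (toℕ t) x)
                     (x∙y⁻¹≈ε⇒x≈y _ _ (trans (sym (Bt≡Dt-Dt0 f x)) Bt≡0)))
    point∈solutions : ∀ i → point i ∈ List.filter (λ y → Dt p f d y ≟ Dt p f d 0#) elems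
    point∈solutions i = ∈-filter⁺ (λ y → Dt p f d y ≟ Dt p f d 0#) (elems-complete (point i)) (solves i)
    off-line : ∀ t u → smul (toℕ t) d ≢ x + smul (toℕ u) d
    off-line t u same = x∉line (fromℕ< t⊖u<p , (begin
      x                                    ≡⟨ sym (xyx⁻¹≈y (smul (toℕ u) d) x) ⟩
      smul (toℕ u) d + x + - smul (toℕ u) d ≡⟨ cong (_+ - smul (toℕ u) d) (trans (+-comm _ x) (sym same)) ⟩
      smul (toℕ t) d + - smul (toℕ u) d     ≡⟨ sym (smul-⊖ (toℕ t) (toℕ u) d (<⇒≤ (toℕ<n u))) ⟩
      smul (toℕ t ⊖ toℕ u) d               ≡⟨ cong (λ k → smul k d) (sym (toℕ-fromℕ< t⊖u<p)) ⟩
      smul (toℕ (fromℕ< t⊖u<p)) d          ∎))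
      where
      t⊖u<p : toℕ t ⊖ toℕ u < p
      t⊖u<p = m%n<n (toℕ t ℕ.+ (p ∸ toℕ u)) p
    point′-injective : ∀ {i j} → point′ i ≡ point′ j → i ≡ j
    point′-injective {inj₁ t} {inj₁ u} same =
      cong inj₁ (toℕ-injective (smul-injective (toℕ<n t) (toℕ<n u) d≢0 same))
    point′-injective {inj₂ t} {inj₂ u} same =
      cong inj₂ (toℕ-injective (smul-injective (toℕ<n t) (toℕ<n u) d≢0 (+-cancelˡ x _ _ same)))
    point′-injective {inj₁ t} {inj₂ u} same = ⊥-elim (off-line t u same)
    point′-injective {inj₂ t} {inj₁ u} same = ⊥-elim (off-line u t (sym same))
    point-injective : ∀ {i j} → point i ≡ point j → i ≡ j
    point-injective {i} {j} same =
      trans (sym (join-splitAt p p i))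
            (trans (cong (join p p) (point′-injective {splitAt p i} {splitAt p j} same)) (join-splitAt p p j))

module BilinearGraphs (K : FiniteField) {p : ℕ} (p-prime : Prime p)
  (char : FieldDefs.smul K p (FiniteField.1# K) ≡ FiniteField.0# K)
  (B : FiniteField.Carrier K → FiniteField.Carrier K → FiniteField.Carrier K)
  (bilinear : FieldDefs.IsBilinear K B) where
  open FiniteField K
  open FieldDefs K
  open FieldProperties K
  open PrimeCharacteristic K p-prime char
  open ≡-Reasoning

  B-+ˡ : ∀ a x y → B (x + y) a ≡ B x a + B y a
  B-+ˡ a = proj₁ (proj₁ bilinear a)

  B-smulˡ : ∀ a j x → B (smul j x) a ≡ smul j (B x a)
  B-smulˡ a = proj₂ (proj₁ bilinear a)

  B-+ʳ : ∀ x a b → B x (a + b) ≡ B x a + B x b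
  B-+ʳ x = proj₁ (proj₂ bilinear x)

  B-smulʳ : ∀ x j a → B x (smul j a) ≡ smul j (B x a)
  B-smulʳ x = proj₂ (proj₂ bilinear x)

  B-zeroˡ : ∀ a → B 0# a ≡ 0#
  B-zeroˡ a = x+x≈x⇒x≈0 _ (trans (sym (B-+ˡ a 0# 0#)) (cong (λ t → B t a) (+-identityʳ 0#)))

  B-zeroʳ : ∀ x → B x 0# ≡ 0#
  B-zeroʳ x = x+x≈x⇒x≈0 _ (trans (sym (B-+ʳ x 0# 0#)) (cong (B x) (+-identityʳ 0#)))

  B-lc-vanishing : ∀ {k} x (as : Vec Carrier k) → (∀ i → B x (lookup as i) ≡ 0#) →
                   ∀ c → B x (lc c as) ≡ 0#
  B-lc-vanishing x []       _         []       = B-zeroʳ x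
  B-lc-vanishing x (a ∷ as) vanishing (c ∷ cs) = begin
    B x (smul c a + lc cs as)          ≡⟨ B-+ʳ x _ _ ⟩
    B x (smul c a) + B x (lc cs as)    ≡⟨ cong₂ _+_ (B-smulʳ x c a) (B-lc-vanishing x as (vanishing ∘ suc) cs) ⟩
    smul c (B x a) + 0#                ≡⟨ trans (+-identityʳ _) (cong (smul c) (vanishing zero)) ⟩
    smul c 0#                          ≡⟨ smul-zeroʳ c ⟩
    0#                                 ∎

  X : Carrier → SubsetV
  X = graphX B

  graph : Carrier → Carrier → V
  graph a x = (x , B x a)

  lincomb-graph : ∀ {k} a (c : Vec ℕ k) bs → lincomb c (Vec.map (graph a) bs) ≡ graph a (lc c bs)
  lincomb-graph a []       []       = cong (0# ,_) (sym (B-zeroˡ a))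
  lincomb-graph a (c ∷ cs) (b ∷ bs) = begin
    smulV c (b , B b a) +V lincomb cs (Vec.map (graph a) bs)
      ≡⟨ cong (smulV c (b , B b a) +V_) (lincomb-graph a cs bs) ⟩
    (smul c b + lc cs bs , smul c (B b a) + B (lc cs bs) a)
      ≡⟨ cong (smul c b + lc cs bs ,_)
              (sym (trans (B-+ˡ a _ _) (cong (_+ B (lc cs bs) a) (B-smulˡ a c b)))) ⟩
    graph a (smul c b + lc cs bs) ∎

  graph-isSubspace : ∀ a → IsSubspace (X a)
  graph-isSubspace a = sym (B-zeroˡ a)
                     , (λ { (x , y) (x′ , y′) y≡ y′≡ → trans (cong₂ _+_ y≡ y′≡) (sym (B-+ˡ a x x′)) })
                     , (λ { j (x , y) y≡ → trans (cong (smul j) y≡) (sym (B-smulˡ a j x)) })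

  graph-hasDim : ∀ {k} {bs : Vec Carrier k} → IsBasis bs → ∀ a → HasDim p (X a) k
  graph-hasDim {bs = bs} (independent , spanning) a =
      Vec.map (graph a) bs
    , (λ i → subst (X a) (sym (lookup-map i (graph a) bs)) refl)
    , (λ { (x , y) y≡ → proj₁ (spanning x)
         , trans (cong₂ _,_ (proj₂ (spanning x)) (trans y≡ (cong (λ t → B t a) (proj₂ (spanning x)))))
                 (sym (lincomb-graph a (proj₁ (spanning x)) bs)) })
    , (λ c c<p lincomb≡0 → independent c c<p (cong proj₁ (trans (sym (lincomb-graph a c bs)) lincomb≡0)))

  ¬SameSet⇒≢ : ∀ {a b} → ¬ SameSet (X a) (X b) → a ≢ b
  ¬SameSet⇒≢ different refl = different (λ _ → (λ v → v) , (λ v → v))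

  B-split : ∀ x a b → B x a ≡ B x (a + - b) + B x b
  B-split x a b = trans (cong (B x) (sym (//-rightDividesˡ b a))) (B-+ʳ x (a + - b) b)

  B-difference : ∀ {x a b} → B x a ≡ B x b → B x (a + - b) ≡ 0#
  B-difference {x} {a} {b} same =
    +-cancelʳ (B x b) _ _ (trans (sym (B-split x a b)) (trans same (sym (+-identityˡ _))))

  sameLine : ∀ {a b c k} → a + - c ≢ 0# → k < p → b + - c ≡ smul k (a + - c) → SameLine p a b c
  sameLine {a} {b} {c} {k} a-c≢0 k<p b-c≡k[a-c] = c , a + - c , a-c≢0
    , (1 , prime>1 p-prime , sym (trans (cong (c +_) (smul-identityˡ _)) (recenter a)))
    , (k , k<p , sym (trans (cong (c +_) (sym b-c≡k[a-c])) (recenter b)))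
    , (0 , ℕ.n≢0⇒n>0 (ℕ.≢-nonZero⁻¹ p) , sym (+-identityʳ c))
    where
    recenter : ∀ x → c + (x + - c) ≡ x
    recenter x = trans (+-comm c _) (//-rightDividesˡ c x)

  module LineKernels (w : Carrier → Carrier) (w-injective : ∀ {a b} → w a ≡ w b → a ≡ b) (w-zero : w 0# ≡ 0#)
           (kernel-∋ : ∀ a → a ≢ 0# → B (w a) a ≡ 0#)
           (kernel-⊆ : ∀ a → a ≢ 0# → ∀ x → B x a ≡ 0# → Σ ℕ λ t → t < p × x ≡ smul t (w a)) where

    w-nonZero : ∀ {a} → a ≢ 0# → w a ≢ 0#
    w-nonZero a≢0 wa≡0 = a≢0 (w-injective (trans wa≡0 (sym w-zero)))

    graph-∩-hasDim : ∀ {a b} → a ≢ b → HasDim p (X a ∩ X b) 1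
    graph-∩-hasDim {a} {b} a≢b = (generator ∷ []) , generator∈ , spanning , independent
      where
      e : Carrier
      e = a + - b
      e≢0 : e ≢ 0#
      e≢0 e≡0 = a≢b (x∙y⁻¹≈ε⇒x≈y a b e≡0)
      generator : V
      generator = graph b (w e)
      generator∈ : ∀ i → (X a ∩ X b) (lookup (generator ∷ []) i)
      generator∈ zero = sym (begin
        B (w e) a              ≡⟨ B-split (w e) a b ⟩
        B (w e) e + B (w e) b  ≡⟨ cong (_+ B (w e) b) (kernel-∋ e e≢0) ⟩
        0# + B (w e) b         ≡⟨ +-identityˡ _ ⟩
        B (w e) b              ∎) , refl
      spanning : ∀ v → (X a ∩ X b) v → Σ (Vec ℕ 1) λ c → v ≡ lincomb c (generator ∷ [])
      spanning (x , y) (y≡Bxa , y≡Bxb)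
        with t , _ , x≡tw ← kernel-⊆ e e≢0 x (B-difference (trans (sym y≡Bxa) y≡Bxb))
        = (t ∷ []) , cong₂ _,_ (trans x≡tw (sym (+-identityʳ _))) (begin
            y                       ≡⟨ y≡Bxb ⟩
            B x b                   ≡⟨ cong (λ u → B u b) x≡tw ⟩
            B (smul t (w e)) b      ≡⟨ B-smulˡ b t (w e) ⟩
            smul t (B (w e) b)      ≡⟨ sym (+-identityʳ _) ⟩
            smul t (B (w e) b) + 0# ∎)
      independent : ∀ c → (∀ i → lookup c i < p) → lincomb c (generator ∷ []) ≡ 0V →
                    ∀ i → lookup c i ≡ 0
      independent (c ∷ []) c<p lincomb≡0 zero = smul≡0⇒coefficient≡0 (c<p zero) (w-nonZero e≢0)
        (trans (sym (+-identityʳ _)) (cong proj₁ lincomb≡0))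

    graph-∩∩-trivial : ∀ {a b c} → a ≢ b → b ≢ c → a ≢ c → ¬ SameLine p a b c →
                       ∀ v → ((X a ∩ X b) ∩ X c) v → v ≡ 0V
    graph-∩∩-trivial {a} {b} {c} a≢b b≢c a≢c not-collinear (x , y) ((y≡Bxa , y≡Bxb) , y≡Bxc)
      with x ≟ 0#
    ... | yes x≡0 = cong₂ _,_ x≡0 (trans y≡Bxa (trans (cong (λ t → B t a) x≡0) (B-zeroˡ a)))
    ... | no x≢0 = ⊥-elim (<⇒≱ p<p^2 (subst (p ^ 2 ℕ.≤_) (List.length-applyUpTo (λ s → smul s x) p)
                                        (injection⇒≤length image image-injective image∈line)))
      where
      0<p : 0 < p
      0<p = ℕ.n≢0⇒n>0 (ℕ.≢-nonZero⁻¹ p)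
      p<p^2 : p < p ^ 2
      p<p^2 = subst (_< p ^ 2) (ℕ.*-identityʳ p) (^-monoʳ-< p (prime>1 p-prime) {1} {2} (s≤s (s≤s z≤n)))
      us : Vec Carrier 2
      us = (a + - c) ∷ (b + - c) ∷ []
      a-c≢0 : a + - c ≢ 0#
      a-c≢0 a-c≡0 = a≢c (x∙y⁻¹≈ε⇒x≈y a c a-c≡0)
      us-independent : Independent us
      us-independent (r ∷ zero ∷ []) r<p lc≡0 zero =
        smul≡0⇒coefficient≡0 (r<p zero) a-c≢0
          (trans (sym (trans (cong (smul r (a + - c) +_) (+-identityʳ 0#)) (+-identityʳ _))) lc≡0)
      us-independent (r ∷ zero ∷ []) r<p lc≡0 (suc zero) = refl
      us-independent (r ∷ suc s ∷ []) r<s<p lc≡0 _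
        with t , inverse-t ← smul-inverse (s≤s z≤n) (r<s<p (suc zero))
        = ⊥-elim (not-collinear (sameLine a-c≢0 (m%n<n (t ℕ.* (p ∸ r)) p) (begin
          b + - c                            ≡⟨ sym (inverse-t _) ⟩
          smul t (smul (suc s) (b + - c))
            ≡⟨ cong (smul t) (inverseʳ-unique _ _
                 (trans (cong (smul r (a + - c) +_) (sym (+-identityʳ _))) lc≡0)) ⟩
          smul t (- smul r (a + - c))        ≡⟨ cong (smul t) (sym (smul-complement r _ (<⇒≤ (r<s<p zero)))) ⟩
          smul t (smul (p ∸ r) (a + - c))    ≡⟨ sym (smul-assoc t (p ∸ r) _) ⟩
          smul (t ℕ.* (p ∸ r)) (a + - c)     ≡⟨ smul-mod _ _ ⟩
          smul ((t ℕ.* (p ∸ r)) % p) (a + - c) ∎)))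
      B-x-us : ∀ i → B x (lookup us i) ≡ 0#
      B-x-us zero       = B-difference (trans (sym y≡Bxa) y≡Bxc)
      B-x-us (suc zero) = B-difference (trans (sym y≡Bxb) y≡Bxc)
      image : Fin (p ^ 2) → Carrier
      image i = w (lc (decode i) us)
      image-injective : ∀ {i j} → image i ≡ image j → i ≡ j
      image-injective same =
        decode-injective (lc-injective us-independent (decode-bounded _) (decode-bounded _) (w-injective same))
      image∈line : ∀ i → image i ∈ List.applyUpTo (λ s → smul s x) p
      image∈line i with lc (decode i) us ≟ 0#
      ... | yes e≡0 = subst (_∈ _) (sym (trans (cong w e≡0) w-zero)) (∈-applyUpTo⁺ (λ s → smul s x) 0<p)
      ... | no e≢0 with kernel-⊆ _ e≢0 x (B-lc-vanishing x us B-x-us (decode i))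
      ...   | zero  , _   , x≡0 = ⊥-elim (x≢0 x≡0)
      ...   | suc t , t<p , x≡tw with s , inverse-s ← smul-inverse (s≤s z≤n) t<p
        = subst (_∈ _) (sym (trans (sym (inverse-s _)) (trans (cong (smul s) (sym x≡tw)) (smul-mod s x))))
                (∈-applyUpTo⁺ (λ s → smul s x) (m%n<n s p))

module TwistedBracket (K : FiniteField) {p : ℕ} (p-prime : Prime p)
  (char : FieldDefs.smul K p (FiniteField.1# K) ≡ FiniteField.0# K)
  (f : FiniteField.Carrier K → FiniteField.Carrier K) (gapn : FieldDefs.GAPN K p f)
  (μ : (a : FiniteField.Carrier K) → a ≢ FiniteField.0# K → FiniteField.Carrier K → FiniteField.Carrier K)
  (μ-aut : ∀ a (a≢0 : a ≢ FiniteField.0# K) → FieldDefs.IsLinearAut K (μ a a≢0))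
  (ν : FiniteField.Carrier K → FiniteField.Carrier K) where
  open FiniteField K
  open FieldDefs K
  open FieldProperties K

  B : Carrier → Carrier → Carrier
  B = Btμν p f μ ν

  -- μ takes the proof of a ≢ 0 as an argument, so the unfolding only fixes some such proof
  unfold-Btμν : ∀ x {a} → a ≢ 0# → Σ (a ≢ 0#) λ a≢0 → B x a ≡ μ a a≢0 (Bt p f x (ν a))
  unfold-Btμν x {a} a≢0 with a ≟ 0#
  ... | yes a≡0 = ⊥-elim (a≢0 a≡0)
  ... | no a≢0′ = a≢0′ , refl

  μ-zero : ∀ a (a≢0 : a ≢ 0#) → μ a a≢0 0# ≡ 0#
  μ-zero a a≢0 =
    x+x≈x⇒x≈0 _ (trans (sym (proj₁ (proj₁ (μ-aut a a≢0)) 0# 0#)) (cong (μ a a≢0) (+-identityʳ 0#)))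

  Btμν-kernel-∋ : ∀ a → a ≢ 0# → B (ν a) a ≡ 0#
  Btμν-kernel-∋ a a≢0 with a≢0′ , B≡μBt ← unfold-Btμν (ν a) a≢0 =
    trans B≡μBt (trans (cong (μ a a≢0′) Bt≡0) (μ-zero a a≢0′))
    where
    Bt≡0 : Bt p f (ν a) (ν a) ≡ 0#
    Bt≡0 = trans (cong (λ u → Bt p f u (ν a)) (sym (smul-identityˡ (ν a))))
                 (GAPNKernel.Bt-line K p-prime char f gapn (ν a) 1)

  Btμν-kernel-⊆ : ν 0# ≡ 0# → (∀ {a b} → ν a ≡ ν b → a ≡ b) →
                  ∀ a → a ≢ 0# → ∀ x → B x a ≡ 0# → Σ ℕ λ t → t < p × x ≡ smul t (ν a)
  Btμν-kernel-⊆ ν0 ν-injective a a≢0 x B≡0 with a≢0′ , B≡μBt ← unfold-Btμν x a≢0 =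
    GAPNKernel.Bt-kernel K p-prime char f gapn (ν a) νa≢0 x
      (proj₁ (proj₂ (μ-aut a a≢0′)) (trans (sym B≡μBt) (trans B≡0 (sym (μ-zero a a≢0′)))))
    where
    νa≢0 : ν a ≢ 0#
    νa≢0 νa≡0 = a≢0 (ν-injective (trans νa≡0 (sym ν0)))

theorem5p5 : (p n : ℕ) → Prime p → 2 ≤ n → (K : FiniteField) →
    let open FiniteField K in
    let open FieldDefs K in
    length elems ≡ p ^ n →
    (f : Carrier → Carrier) → GAPN p f → AlgDegree f p →
    (μ : (a : Carrier) → a ≢ 0# → Carrier → Carrier) →
    (∀ a (a≢0 : a ≢ 0#) → IsLinearAut (μ a a≢0)) →
    (ν : Carrier → Carrier) → Bijective _≡_ _≡_ ν → ν 0# ≡ 0# →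
    IsBilinear (Btμν p f μ ν) →
    (M : Carrier → Set) → NoThreeOnLine p M →
    DualArc p n M (graphX (Btμν p f μ ν))
theorem5p5 p n p-prime 2≤n K card f gapn _ μ μ-aut ν (ν-injective , _) ν0 bilinear M no-three-on-line =
    (λ a _ → graph-isSubspace a , subst (HasDim p (X a)) k≡n (graph-hasDim isBasis a))
  , (λ a b _ _ X[a]≠X[b] → graph-∩-hasDim (¬SameSet⇒≢ X[a]≠X[b]))
  , λ a b c a∈M b∈M c∈M X[a]≠X[b] X[b]≠X[c] X[a]≠X[c] →
      let a≢b = ¬SameSet⇒≢ X[a]≠X[b]; b≢c = ¬SameSet⇒≢ X[b]≠X[c]; a≢c = ¬SameSet⇒≢ X[a]≠X[c] in
      graph-∩∩-trivial a≢b b≢c a≢c (no-three-on-line a b c a∈M b∈M c∈M a≢b b≢c a≢c)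
  where
  open FiniteField K
  open FieldDefs K
  char : smul p 1# ≡ 0#
  char = characteristic K p-prime (ℕ.≤-trans (s≤s z≤n) 2≤n) card
  open PrimeCharacteristic K p-prime char using (IsBasis; basis; basis-card)
  open BilinearGraphs K p-prime char (Btμν p f μ ν) bilinear
  open TwistedBracket K p-prime char f gapn μ μ-aut ν
  open LineKernels ν ν-injective ν0 Btμν-kernel-∋ (Btμν-kernel-⊆ ν0 ν-injective)
  k : ℕ
  k = proj₁ basis
  isBasis : IsBasis (proj₁ (proj₂ basis))
  isBasis = proj₂ (proj₂ basis)
  k≡n : k ≡ n
  k≡n = ^-injectiveʳ (prime>1 p-prime) (trans (sym (basis-card isBasis)) card)
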